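{- Let $\mathcal{G}=(V,\mathcal{E})$ be a hypergraph, let $\mathcal{E}_1,\mathcal{E}_2\subseteq \mathcal{E}$, and let $\mathcal{P}_1,\mathcal{P}_2$ be partitions of $V$. Then $$e_{\mathcal{E}_1}(\mathcal{P}_1)+e_{\mathcal{E}_2}(\mathcal{P}_2)\ \ge\ e_{\mathcal{E}_1\cap\mathcal{E}_2}(\mathcal{P}_1\sqcap\mathcal{P}_2)+e_{\mathcal{E}_1\cup\mathcal{E}_2}(\mathcal{P}_1\sqcup\mathcal{P}_2),$$ for any outcome of the uncrossing procedure defining $\mathcal{P}_1\sqcap\mathcal{P}_2$.
   Context: $V$ is a finite set. A hypergraph $(V,\mathcal{E})$ has hyperedges that are subsets of $V$ of size at least two (multiplicities allowed). For a set $\mathcal{F}$ of hyperedges and a partition $\mathcal{P}$ of $V$, $e_{\mathcal{F}}(\mathcal{P})$ denotes the number of hyperedges of $\mathcal{F}$ not contained in a single member of $\mathcal{P}$. Two subsets $X,Y$ of $V$ are properly intersecting if $X\cap Y$, $X\setminus Y$, $Y\setminus X$ are all nonempty. For partitions $\mathcal{P}_1,\mathcal{P}_2$ of $V$, start from the family $\mathcal{P}_1\cup\mathcal{P}_2$ (with multiplicities) and repeatedly replace two properly intersecting members $X,Y$ by $X\cap Y$ and $X\cup Y$ until no properly intersecting pair remains. The minimal members of the resulting family form a partition $\mathcal{P}_1\sqcap\mathcal{P}_2$ of $V$ (which may depend on the choices made) and the maximal members form a partition $\mathcal{P}_1\sqcup\mathcal{P}_2$ of $V$ (which is uniquely determined).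 -}

module Defs where

open import Data.Nat using (ℕ; _≤_)
open import Data.Fin using (Fin)
open import Data.Fin.Subset using (Subset; _∈_; _⊆_; _⊂_; _∩_; _∪_; _─_; Nonempty; Empty; ∣_∣)
open import Data.Fin.Subset.Properties using (_∈?_; _⊆?_; _⊂?_)
open import Data.List using (List; []; _∷_; filter; length; allFin)
open import Data.List.Relation.Unary.All using (All)
open import Data.List.Relation.Unary.Any using (Any; any?)
open import Data.List.Relation.Unary.AllPairs using (AllPairs)
open import Data.List.Relation.Binary.Permutation.Propositional using (_↭_)
open import Data.Product using (Σ; ∃; _×_; _,_)
open import Relation.Nullary using (¬_; ¬?)
open import Relation.Nullary.Decidable using (_×-dec_)
open import Relation.Binary.PropositionalEquality using (_≡_)
open import Relation.Binary.Construct.Closure.ReflexiveTransitive using (Star)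

-- Vertex set V = Fin n.  A hypergraph on V with m hyperedges (multiplicities
-- allowed) is an indexed family  E : Fin m → Subset n , each of size ≥ 2.
IsHypergraph : {n m : ℕ} → (Fin m → Subset n) → Set
IsHypergraph {n} {m} E = ∀ (i : Fin m) → 2 ≤ ∣ E i ∣

Family : ℕ → Set
Family n = List (Subset n)

IsPartition : {n : ℕ} → Family n → Set
IsPartition {n} P =
  All Nonempty P
  × AllPairs (λ X Y → Empty (X ∩ Y)) P
  × (∀ (x : Fin n) → Any (x ∈_) P)

-- e_F(P): number of hyperedges of F (F a set of hyperedge indices, i.e. a
-- sub-multiset of E) not contained in a single member of P.
eCount : {n m : ℕ} → (Fin m → Subset n) → Subset m → Family n → ℕ
eCount {n} {m} E F P =
  length (filter (λ i → (i ∈? F) ×-dec ¬? (any? (λ X → E i ⊆? X) P)) (allFin m))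

ProperlyIntersecting : {n : ℕ} → Subset n → Subset n → Set
ProperlyIntersecting X Y = Nonempty (X ∩ Y) × Nonempty (X ─ Y) × Nonempty (Y ─ X)

UncrossStep : {n : ℕ} → Family n → Family n → Set
UncrossStep {n} F G =
  Σ (Subset n) λ X → Σ (Subset n) λ Y → Σ (Family n) λ R →
    (F ↭ (X ∷ Y ∷ R)) × ProperlyIntersecting X Y × (G ≡ (X ∩ Y) ∷ (X ∪ Y) ∷ R)

Uncross : {n : ℕ} → Family n → Family n → Set
Uncross = Star UncrossStep

Uncrossed : {n : ℕ} → Family n → Set
Uncrossed {n} F =
  ∀ (X Y : Subset n) (R : Family n) → F ↭ (X ∷ Y ∷ R) → ¬ ProperlyIntersecting X Y

minimalMembers : {n : ℕ} → Family n → Family n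
minimalMembers F = filter (λ X → ¬? (any? (λ Y → Y ⊂? X) F)) F

maximalMembers : {n : ℕ} → Family n → Family n
maximalMembers F = filter (λ X → ¬? (any? (λ Y → X ⊂? Y) F)) F

{-# OPTIONS --safe #-}
module Submission where

-- Uncrossing keeps, for every vertex v, the number of members containing v
-- (v ∈ X ∩ Y, X ∪ Y exactly as often as v ∈ X, Y), and never decreases, for a
-- set e, the number of members containing e (e ⊆ X, Y gives e ⊆ X ∩ Y, X ∪ Y).
-- Starting from two partitions, every vertex thus lies in at most two members
-- of the final family F.  A hyperedge inside a part of P₁ or of P₂ lies inside
-- a member of F, hence inside a maximal one: a chain A ⊂ B ⊂ C in F would put
-- a vertex of A into three members.  A hyperedge inside a part of P₁ and a
-- part of P₂ lies inside two members of F; they meet, so being uncrossed they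
-- are nested, and the smaller one is minimal by the same depth argument.
-- The inequality then holds hyperedge by hyperedge, because
-- [C] + [D] ≤ [A] + [B] whenever C ∧ D ⇒ A ∧ B and C ∨ D ⇒ A ∨ B.

open import Defs
open import Data.Empty using (⊥; ⊥-elim)
open import Data.Fin using (Fin)
open import Data.Fin.Subset
  using (Subset; _∈_; _⊆_; _⊂_; _∩_; _∪_; _─_; Nonempty; Empty; ∣_∣)
open import Data.Fin.Subset.Properties
  using (_∈?_; _⊆?_; _⊂?_; nonempty?; Empty-unique; ∣⊥∣≡0; ⊆-refl; ⊆-trans; p⊂q⇒p⊆q;
         ⊂-trans; ⊂-⊆-trans; ⊂-irref; x∈p∩q⁺; x∈p∩q⁻; x∈p∪q⁻; p⊆p∪q; q⊆p∪q;
         x∈p∧x∉q⇒x∈p─q)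
open import Data.List using (List; []; _∷_; _++_; length; filter; allFin)
open import Data.List.Properties using (length-++; filter-++; filter-all; filter-none)
open import Data.List.Membership.Propositional
  using (find; lose) renaming (_∈_ to _∈ₗ_; _∉_ to _∉ₗ_)
open import Data.List.Membership.Propositional.Properties using (∈-filter⁺; ∈-∃++; ∈-++⁻)
open import Data.List.Relation.Unary.All as All using (All; []; _∷_)
open import Data.List.Relation.Unary.All.Properties using () renaming (++⁺ to All-++⁺)
open import Data.List.Relation.Unary.Any as Any using (Any; here; there; any?)
open import Data.List.Relation.Unary.Any.Properties
  using () renaming (++⁺ˡ to Any-++⁺ˡ; ++⁺ʳ to Any-++⁺ʳ)
open import Data.List.Relation.Unary.AllPairs using (AllPairs; []; _∷_)
open import Data.List.Relation.Binary.Permutation.Propositional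
  using (_↭_; prep; swap; ↭-refl; ↭-sym; ↭-trans)
import Data.List.Relation.Binary.Permutation.Propositional.Properties as ↭
open import Data.Nat using (ℕ; _+_; _≤_; _<_; _≥_; z≤n; s≤s)
open import Data.Nat.Properties
  using (≤-refl; ≤-trans; ≤-reflexive; <⇒≤; <-irrefl; m≤m+n; m≤n+m; +-mono-≤; +-monoˡ-≤;
         +-assoc; +-commutativeSemigroup; module ≤-Reasoning)
open import Algebra.Properties.CommutativeSemigroup +-commutativeSemigroup using (interchange)
open import Data.Product using (_×_; _,_; proj₁; proj₂; ∃-syntax)
open import Data.Sum using (_⊎_; inj₁; inj₂; [_,_])
open import Function using (_∘_)
open import Relation.Nullary using (¬_; Dec; yes; no; ¬?; contradiction)
open import Relation.Nullary.Decidable using (_×-dec_)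
open import Relation.Unary using (Pred; Decidable)
open import Relation.Binary.PropositionalEquality
  using (_≡_; refl; sym; trans; cong; cong₂; module ≡-Reasoning)
open import Relation.Binary.Construct.Closure.ReflexiveTransitive using (ε; _◅_)

indicator : ∀ {p} {P : Set p} → Dec P → ℕ
indicator (yes _) = 1
indicator (no _)  = 0

indicator-pos : ∀ {p} {P : Set p} (P? : Dec P) → P → 1 ≤ indicator P?
indicator-pos (yes _) _  = ≤-refl
indicator-pos (no ¬p) p = contradiction p ¬p

indicator-+-pos : ∀ {a b} {A : Set a} {B : Set b} (A? : Dec A) (B? : Dec B) →
                  A ⊎ B → 1 ≤ indicator A? + indicator B?
indicator-+-pos A? B? (inj₁ a) = ≤-trans (indicator-pos A? a) (m≤m+n _ _)
indicator-+-pos A? B? (inj₂ b) = ≤-trans (indicator-pos B? b) (m≤n+m _ _)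

indicator-+-mono : ∀ {a b c d} {A : Set a} {B : Set b} {C : Set c} {D : Set d}
                   (A? : Dec A) (B? : Dec B) (C? : Dec C) (D? : Dec D) →
                   (C × D → A × B) → (C ⊎ D → A ⊎ B) →
                   indicator C? + indicator D? ≤ indicator A? + indicator B?
indicator-+-mono A? B? (yes c) (yes d) both _ =
  +-mono-≤ (indicator-pos A? (proj₁ (both (c , d)))) (indicator-pos B? (proj₂ (both (c , d))))
indicator-+-mono A? B? (yes c) (no _)  _ either = indicator-+-pos A? B? (either (inj₁ c))
indicator-+-mono A? B? (no _)  (yes d) _ either = indicator-+-pos A? B? (either (inj₂ d))
indicator-+-mono A? B? (no _)  (no _)  _ _      = z≤n

module _ {a p} {A : Set a} {P : Pred A p} (P? : Decidable P) where

  count : List A → ℕ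
  count xs = length (filter P? xs)

  count-∷ : ∀ x xs → count (x ∷ xs) ≡ indicator (P? x) + count xs
  count-∷ x xs with P? x
  ... | yes _ = refl
  ... | no _  = refl

  count-∷∷ : ∀ x y xs → count (x ∷ y ∷ xs) ≡ (indicator (P? x) + indicator (P? y)) + count xs
  count-∷∷ x y xs = begin
    count (x ∷ y ∷ xs)
      ≡⟨ count-∷ x (y ∷ xs) ⟩
    indicator (P? x) + count (y ∷ xs)
      ≡⟨ cong (indicator (P? x) +_) (count-∷ y xs) ⟩
    indicator (P? x) + (indicator (P? y) + count xs)
      ≡⟨ +-assoc (indicator (P? x)) _ _ ⟨
    (indicator (P? x) + indicator (P? y)) + count xs ∎
    where open ≡-Reasoning

  count-↭ : ∀ {xs ys} → xs ↭ ys → count xs ≡ count ys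
  count-↭ xs↭ys = ↭.↭-length (↭.filter-↭ P? xs↭ys)

  count-++ : ∀ xs ys → count (xs ++ ys) ≡ count xs + count ys
  count-++ xs ys = trans (cong length (filter-++ P? xs ys)) (length-++ (filter P? xs))

  All⇒length≤count : ∀ {xs} ys → All P xs → length xs ≤ count (xs ++ ys)
  All⇒length≤count {xs} ys pxs = begin
    length xs              ≡⟨ cong length (filter-all P? pxs) ⟨
    count xs               ≤⟨ m≤m+n _ _ ⟩
    count xs + count ys    ≡⟨ count-++ xs ys ⟨
    count (xs ++ ys)       ∎
    where open ≤-Reasoning

  Any⇒count-pos : ∀ {xs} → Any P xs → 1 ≤ count xs
  Any⇒count-pos {x ∷ xs} any with P? x | any
  ... | yes _  | _          = s≤s z≤n
  ... | no ¬px | here px    = contradiction px ¬px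
  ... | no _   | there any′ = Any⇒count-pos any′

  count-pos⇒↭∷ : ∀ xs → 1 ≤ count xs → ∃[ y ] ∃[ ys ] (xs ↭ y ∷ ys × P y)
  count-pos⇒↭∷ (x ∷ xs) pos with P? x
  ... | yes px = x , xs , ↭-refl , px
  ... | no _ with y , ys , xs↭ , py ← count-pos⇒↭∷ xs pos =
    y , x ∷ ys , ↭-trans (prep x xs↭) (swap x y ↭-refl) , py

  count≥2⇒↭∷∷ : ∀ xs → 2 ≤ count xs → ∃[ y ] ∃[ z ] ∃[ ys ] (xs ↭ y ∷ z ∷ ys × P y × P z)
  count≥2⇒↭∷∷ (x ∷ xs) two with P? x | two
  ... | yes px | s≤s pos with y , ys , xs↭ , py ← count-pos⇒↭∷ xs pos =
    x , y , ys , prep x xs↭ , px , py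
  ... | no _ | two′ with y , z , ys , xs↭ , py , pz ← count≥2⇒↭∷∷ xs two′ =
    y , z , x ∷ ys , ↭-trans (prep x xs↭) (↭-trans (swap x y ↭-refl) (prep y (swap x z ↭-refl))) ,
    py , pz

count-+-mono : ∀ {a p q r s} {A : Set a} {P : Pred A p} {Q : Pred A q} {R : Pred A r} {S : Pred A s}
               (P? : Decidable P) (Q? : Decidable Q) (R? : Decidable R) (S? : Decidable S) →
               (∀ x → R x × S x → P x × Q x) → (∀ x → R x ⊎ S x → P x ⊎ Q x) →
               ∀ xs → count R? xs + count S? xs ≤ count P? xs + count Q? xs
count-+-mono P? Q? R? S? both either []       = z≤n
count-+-mono P? Q? R? S? both either (x ∷ xs) = begin
  count R? (x ∷ xs) + count S? (x ∷ xs)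
    ≡⟨ cong₂ _+_ (count-∷ R? x xs) (count-∷ S? x xs) ⟩
  (indicator (R? x) + count R? xs) + (indicator (S? x) + count S? xs)
    ≡⟨ interchange (indicator (R? x)) (count R? xs) (indicator (S? x)) (count S? xs) ⟩
  (indicator (R? x) + indicator (S? x)) + (count R? xs + count S? xs)
    ≤⟨ +-mono-≤ (indicator-+-mono (P? x) (Q? x) (R? x) (S? x) (both x) (either x))
                (count-+-mono P? Q? R? S? both either xs) ⟩
  (indicator (P? x) + indicator (Q? x)) + (count P? xs + count Q? xs)
    ≡⟨ interchange (indicator (P? x)) (indicator (Q? x)) (count P? xs) (count Q? xs) ⟩
  (indicator (P? x) + count P? xs) + (indicator (Q? x) + count Q? xs)
    ≡⟨ cong₂ _+_ (count-∷ P? x xs) (count-∷ Q? x xs) ⟨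
  count P? (x ∷ xs) + count Q? (x ∷ xs) ∎
  where open ≤-Reasoning

↭-extract : ∀ {a} {A : Set a} {x : A} {xs} ys {zs} →
            xs ↭ ys ++ zs → x ∈ₗ xs → x ∉ₗ ys → ∃[ ws ] xs ↭ ys ++ x ∷ ws
↭-extract ys xs↭ x∈xs x∉ys with ∈-++⁻ ys (↭.∈-resp-↭ xs↭ x∈xs)
... | inj₁ x∈ys = contradiction x∈ys x∉ys
... | inj₂ x∈zs with us , vs , refl ← ∈-∃++ x∈zs =
  us ++ vs , ↭-trans xs↭ (↭.++⁺ˡ ys (↭.shift _ us vs))

module _ {n p} {P : Pred (Subset n) p} (P? : Decidable P) where

  private
    ι : Subset n → ℕ
    ι X = indicator (P? X)

  uncross-count-mono : (∀ X Y → ι X + ι Y ≤ ι (X ∩ Y) + ι (X ∪ Y)) →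
                       ∀ {F G} → Uncross F G → count P? F ≤ count P? G
  uncross-count-mono step ε = ≤-refl
  uncross-count-mono step {F} {H} ((X , Y , R , F↭ , _ , refl) ◅ G⇝H) = begin
    count P? F                              ≡⟨ count-↭ P? F↭ ⟩
    count P? (X ∷ Y ∷ R)                    ≡⟨ count-∷∷ P? X Y R ⟩
    (ι X + ι Y) + count P? R                ≤⟨ +-monoˡ-≤ (count P? R) (step X Y) ⟩
    (ι (X ∩ Y) + ι (X ∪ Y)) + count P? R    ≡⟨ count-∷∷ P? (X ∩ Y) (X ∪ Y) R ⟨
    count P? (X ∩ Y ∷ X ∪ Y ∷ R)            ≤⟨ uncross-count-mono step G⇝H ⟩
    count P? H                              ∎
    where open ≤-Reasoning

  uncross-count-antitone : (∀ X Y → ι (X ∩ Y) + ι (X ∪ Y) ≤ ι X + ι Y) →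
                           ∀ {F G} → Uncross F G → count P? G ≤ count P? F
  uncross-count-antitone step ε = ≤-refl
  uncross-count-antitone step {F} {H} ((X , Y , R , F↭ , _ , refl) ◅ G⇝H) = begin
    count P? H                              ≤⟨ uncross-count-antitone step G⇝H ⟩
    count P? (X ∩ Y ∷ X ∪ Y ∷ R)            ≡⟨ count-∷∷ P? (X ∩ Y) (X ∪ Y) R ⟩
    (ι (X ∩ Y) + ι (X ∪ Y)) + count P? R    ≤⟨ +-monoˡ-≤ (count P? R) (step X Y) ⟩
    (ι X + ι Y) + count P? R                ≡⟨ count-∷∷ P? X Y R ⟨
    count P? (X ∷ Y ∷ R)                    ≡⟨ count-↭ P? F↭ ⟨
    count P? F                              ∎
    where open ≤-Reasoning

uncross-nonempty : ∀ {n} {F G : Family n} → Uncross F G → All Nonempty F → All Nonempty G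
uncross-nonempty ε F≢∅ = F≢∅
uncross-nonempty ((X , Y , R , F↭ , (X∩Y≢∅ , _) , refl) ◅ G⇝H) F≢∅
  with (x , x∈X) ∷ _ ∷ R≢∅ ← ↭.All-resp-↭ F↭ F≢∅ =
  uncross-nonempty G⇝H (X∩Y≢∅ ∷ (x , p⊆p∪q Y x∈X) ∷ R≢∅)

indicator-∈-∩-∪ : ∀ {n} (v : Fin n) X Y →
  indicator (v ∈? X ∩ Y) + indicator (v ∈? X ∪ Y) ≤ indicator (v ∈? X) + indicator (v ∈? Y)
indicator-∈-∩-∪ v X Y = indicator-+-mono (v ∈? X) (v ∈? Y) (v ∈? X ∩ Y) (v ∈? X ∪ Y)
  (x∈p∩q⁻ X Y ∘ proj₁) [ inj₁ ∘ proj₁ ∘ x∈p∩q⁻ X Y , x∈p∪q⁻ X Y ]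

indicator-⊆-∩-∪ : ∀ {n} (e : Subset n) X Y →
  indicator (e ⊆? X) + indicator (e ⊆? Y) ≤ indicator (e ⊆? X ∩ Y) + indicator (e ⊆? X ∪ Y)
indicator-⊆-∩-∪ e X Y = indicator-+-mono (e ⊆? X ∩ Y) (e ⊆? X ∪ Y) (e ⊆? X) (e ⊆? Y)
  (λ (e⊆X , e⊆Y) → (λ v∈e → x∈p∩q⁺ (e⊆X v∈e , e⊆Y v∈e)) , p⊆p∪q Y ∘ e⊆X)
  [ (λ e⊆X → inj₂ (p⊆p∪q Y ∘ e⊆X)) , (λ e⊆Y → inj₂ (q⊆p∪q X Y ∘ e⊆Y)) ]

PairwiseDisjoint : ∀ {n} → Family n → Set
PairwiseDisjoint = AllPairs (λ X Y → Empty (X ∩ Y))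

disjoint-depth≤1 : ∀ {n} {P : Family n} → PairwiseDisjoint P → ∀ v → count (v ∈?_) P ≤ 1
disjoint-depth≤1 []                    v = z≤n
disjoint-depth≤1 {P = X ∷ _} (X#P ∷ P#) v with v ∈? X
... | no _    = disjoint-depth≤1 P# v
... | yes v∈X = s≤s (≤-reflexive (cong length (filter-none (v ∈?_) (All.map v∉ X#P))))
  where
  v∉ : ∀ {Y} → Empty (X ∩ Y) → ¬ v ∈ Y
  v∉ X∩Y≡∅ v∈Y = X∩Y≡∅ (v , x∈p∩q⁺ (v∈X , v∈Y))

Empty-p─q⇒p⊆q : ∀ {n} {p q : Subset n} → Empty (p ─ q) → p ⊆ q
Empty-p─q⇒p⊆q {q = q} p─q≡∅ {x} x∈p with x ∈? q
... | yes x∈q = x∈q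
... | no x∉q  = contradiction (x , x∈p∧x∉q⇒x∈p─q x∈p x∉q) p─q≡∅

0<∣p∣⇒Nonempty : ∀ {n} (p : Subset n) → 0 < ∣ p ∣ → Nonempty p
0<∣p∣⇒Nonempty {n} p 0<∣p∣ with nonempty? p
... | yes p≢∅ = p≢∅
... | no p≡∅  = ⊥-elim (<-irrefl (sym (trans (cong ∣_∣ (Empty-unique p≡∅)) (∣⊥∣≡0 n))) 0<∣p∣)

module Depth≤2 {n} {F : Family n} (F-nonempty : All Nonempty F)
               (depth≤2 : ∀ v → count (v ∈?_) F ≤ 2) where

  private
    maximal? : Decidable (λ X → ¬ Any (X ⊂_) F)
    maximal? X = ¬? (any? (X ⊂?_) F)

    minimal? : Decidable (λ X → ¬ Any (_⊂ X) F)
    minimal? X = ¬? (any? (_⊂? X) F)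

  no-three-sharing : ∀ {A B C R w} → F ↭ A ∷ B ∷ C ∷ R → w ∈ A → w ∈ B → w ∈ C → ⊥
  no-three-sharing {A} {B} {C} {R} {w} F↭ w∈A w∈B w∈C = <-irrefl refl (begin
    3                                 ≤⟨ All⇒length≤count (w ∈?_) R (w∈A ∷ w∈B ∷ w∈C ∷ []) ⟩
    count (w ∈?_) (A ∷ B ∷ C ∷ R)     ≡⟨ count-↭ (w ∈?_) F↭ ⟨
    count (w ∈?_) F                   ≤⟨ depth≤2 w ⟩
    2                                 ∎)
    where open ≤-Reasoning

  no-⊂-chain : ∀ {A B C} → A ∈ₗ F → B ∈ₗ F → C ∈ₗ F → A ⊂ B → B ⊂ C → ⊥
  no-⊂-chain {A} {B} A∈F B∈F C∈F A⊂B B⊂C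
    with _ , F↭₁ ← ↭-extract [] ↭-refl A∈F (λ ())
    with _ , F↭₂ ← ↭-extract (A ∷ []) F↭₁ B∈F (λ { (here refl) → ⊂-irref refl A⊂B })
    with _ , F↭₃ ← ↭-extract (A ∷ B ∷ []) F↭₂ C∈F
           (λ { (here refl) → ⊂-irref refl (⊂-trans A⊂B B⊂C)
              ; (there (here refl)) → ⊂-irref refl B⊂C })
    with w , w∈A ← All.lookup F-nonempty A∈F
    = no-three-sharing F↭₃ w∈A (p⊂q⇒p⊆q A⊂B w∈A) (p⊂q⇒p⊆q B⊂C (p⊂q⇒p⊆q A⊂B w∈A))

  ⊆-maximal : ∀ {A} → A ∈ₗ F → Any (A ⊆_) (maximalMembers F)
  ⊆-maximal {A} A∈F with any? (A ⊂?_) F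
  ... | no A-maximal = lose (∈-filter⁺ maximal? A∈F A-maximal) ⊆-refl
  ... | yes A⊂F with B , B∈F , A⊂B ← find A⊂F with any? (B ⊂?_) F
  ...   | no B-maximal = lose (∈-filter⁺ maximal? B∈F B-maximal) (p⊂q⇒p⊆q A⊂B)
  ...   | yes B⊂F with C , C∈F , B⊂C ← find B⊂F = ⊥-elim (no-⊂-chain A∈F B∈F C∈F A⊂B B⊂C)

  ⊆-minimal : ∀ {A B R} → F ↭ A ∷ B ∷ R → A ⊆ B → A ∈ₗ minimalMembers F
  ⊆-minimal {A} {B} F↭ A⊆B with any? (_⊂? A) F
  ... | no A-minimal = ∈-filter⁺ minimal? (↭.∈-resp-↭ (↭-sym F↭) (here refl)) A-minimal
  ... | yes ⊂A with Z , Z∈F , Z⊂A ← find ⊂A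
    with _ , F↭′ ← ↭-extract (A ∷ B ∷ []) F↭ Z∈F
           (λ { (here refl) → ⊂-irref refl Z⊂A
              ; (there (here refl)) → ⊂-irref refl (⊂-⊆-trans Z⊂A A⊆B) })
    with w , w∈Z ← All.lookup F-nonempty Z∈F
    = ⊥-elim (no-three-sharing F↭′ (p⊂q⇒p⊆q Z⊂A w∈Z) (A⊆B (p⊂q⇒p⊆q Z⊂A w∈Z)) w∈Z)

  shared-⊆-minimal : Uncrossed F → ∀ {e A B R} → Nonempty e → F ↭ A ∷ B ∷ R →
                     e ⊆ A → e ⊆ B → Any (e ⊆_) (minimalMembers F)
  shared-⊆-minimal F-uncrossed {A = A} {B} {R} (v , v∈e) F↭ e⊆A e⊆B
    with nonempty? (A ─ B) | nonempty? (B ─ A)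
  ... | yes A─B≢∅ | yes B─A≢∅ =
    ⊥-elim (F-uncrossed A B R F↭ ((v , x∈p∩q⁺ (e⊆A v∈e , e⊆B v∈e)) , A─B≢∅ , B─A≢∅))
  ... | no A─B≡∅ | _ = lose (⊆-minimal F↭ (Empty-p─q⇒p⊆q A─B≡∅)) e⊆A
  ... | yes _ | no B─A≡∅ =
    lose (⊆-minimal (↭-trans F↭ (swap A B ↭-refl)) (Empty-p─q⇒p⊆q B─A≡∅)) e⊆B

module UncrossingTwoPartitions {n} {P₁ P₂ F : Family n}
    (P₁-nonempty : All Nonempty P₁) (P₁-disjoint : PairwiseDisjoint P₁)
    (P₂-nonempty : All Nonempty P₂) (P₂-disjoint : PairwiseDisjoint P₂)
    (P₁P₂⇝F : Uncross (P₁ ++ P₂) F) where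

  depth≤2 : ∀ v → count (v ∈?_) F ≤ 2
  depth≤2 v = begin
    count (v ∈?_) F
      ≤⟨ uncross-count-antitone (v ∈?_) (indicator-∈-∩-∪ v) P₁P₂⇝F ⟩
    count (v ∈?_) (P₁ ++ P₂)
      ≡⟨ count-++ (v ∈?_) P₁ P₂ ⟩
    count (v ∈?_) P₁ + count (v ∈?_) P₂
      ≤⟨ +-mono-≤ (disjoint-depth≤1 P₁-disjoint v) (disjoint-depth≤1 P₂-disjoint v) ⟩
    2 ∎
    where open ≤-Reasoning

  open Depth≤2 (uncross-nonempty P₁P₂⇝F (All-++⁺ P₁-nonempty P₂-nonempty)) depth≤2

  containment-grows : ∀ e → count (e ⊆?_) (P₁ ++ P₂) ≤ count (e ⊆?_) F
  containment-grows e = uncross-count-mono (e ⊆?_) (indicator-⊆-∩-∪ e) P₁P₂⇝F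

  inside-one⇒inside-maximal : ∀ {e} → Any (e ⊆_) (P₁ ++ P₂) → Any (e ⊆_) (maximalMembers F)
  inside-one⇒inside-maximal {e} e⊆P
    with A , _ , F↭ , e⊆A ← count-pos⇒↭∷ (e ⊆?_) F
                               (≤-trans (Any⇒count-pos (e ⊆?_) e⊆P) (containment-grows e))
    = Any.map (⊆-trans e⊆A) (⊆-maximal (↭.∈-resp-↭ (↭-sym F↭) (here refl)))

  inside-both⇒twice-in-F : ∀ {e} → Any (e ⊆_) P₁ → Any (e ⊆_) P₂ → 2 ≤ count (e ⊆?_) F
  inside-both⇒twice-in-F {e} e⊆P₁ e⊆P₂ = begin
    2
      ≤⟨ +-mono-≤ (Any⇒count-pos (e ⊆?_) e⊆P₁) (Any⇒count-pos (e ⊆?_) e⊆P₂) ⟩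
    count (e ⊆?_) P₁ + count (e ⊆?_) P₂
      ≡⟨ count-++ (e ⊆?_) P₁ P₂ ⟨
    count (e ⊆?_) (P₁ ++ P₂)
      ≤⟨ containment-grows e ⟩
    count (e ⊆?_) F ∎
    where open ≤-Reasoning

  inside-both⇒inside-minimal : Uncrossed F → ∀ {e} → Nonempty e →
                               Any (e ⊆_) P₁ → Any (e ⊆_) P₂ → Any (e ⊆_) (minimalMembers F)
  inside-both⇒inside-minimal F-uncrossed {e} e≢∅ e⊆P₁ e⊆P₂
    with _ , _ , _ , F↭ , e⊆A , e⊆B ← count≥2⇒↭∷∷ (e ⊆?_) F (inside-both⇒twice-in-F e⊆P₁ e⊆P₂)
    = shared-⊆-minimal F-uncrossed e≢∅ F↭ e⊆A e⊆B

eCount-∩-∪-≤ : ∀ {n m} (E : Fin m → Subset n) (E₁ E₂ : Subset m) (P₁ P₂ Q R : Family n) →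
               (∀ i → Any (E i ⊆_) P₁ → Any (E i ⊆_) R) →
               (∀ i → Any (E i ⊆_) P₂ → Any (E i ⊆_) R) →
               (∀ i → Any (E i ⊆_) P₁ → Any (E i ⊆_) P₂ → Any (E i ⊆_) Q) →
               eCount E (E₁ ∩ E₂) Q + eCount E (E₁ ∪ E₂) R ≤ eCount E E₁ P₁ + eCount E E₂ P₂
eCount-∩-∪-≤ {n} {m} E E₁ E₂ P₁ P₂ Q R P₁⇒R P₂⇒R P₁P₂⇒Q =
  count-+-mono (crossing? E₁ P₁) (crossing? E₂ P₂) (crossing? (E₁ ∩ E₂) Q) (crossing? (E₁ ∪ E₂) R)
               both either (allFin m)
  where
  crossing? : (G : Subset m) (P : Family n) → Decidable (λ i → i ∈ G × ¬ Any (E i ⊆_) P)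
  crossing? G P i = (i ∈? G) ×-dec ¬? (any? (E i ⊆?_) P)

  both : ∀ i → (i ∈ E₁ ∩ E₂ × ¬ Any (E i ⊆_) Q) × (i ∈ E₁ ∪ E₂ × ¬ Any (E i ⊆_) R) →
         (i ∈ E₁ × ¬ Any (E i ⊆_) P₁) × (i ∈ E₂ × ¬ Any (E i ⊆_) P₂)
  both i ((i∈E₁∩E₂ , _) , (_ , ¬R)) with i∈E₁ , i∈E₂ ← x∈p∩q⁻ E₁ E₂ i∈E₁∩E₂ =
    (i∈E₁ , ¬R ∘ P₁⇒R i) , (i∈E₂ , ¬R ∘ P₂⇒R i)

  either : ∀ i → (i ∈ E₁ ∩ E₂ × ¬ Any (E i ⊆_) Q) ⊎ (i ∈ E₁ ∪ E₂ × ¬ Any (E i ⊆_) R) →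
           (i ∈ E₁ × ¬ Any (E i ⊆_) P₁) ⊎ (i ∈ E₂ × ¬ Any (E i ⊆_) P₂)
  either i (inj₁ (i∈E₁∩E₂ , ¬Q)) with i∈E₁ , i∈E₂ ← x∈p∩q⁻ E₁ E₂ i∈E₁∩E₂ | any? (E i ⊆?_) P₁
  ... | yes e⊆P₁ = inj₂ (i∈E₂ , ¬Q ∘ P₁P₂⇒Q i e⊆P₁)
  ... | no ¬P₁   = inj₁ (i∈E₁ , ¬P₁)
  either i (inj₂ (i∈E₁∪E₂ , ¬R)) =
    [ (λ i∈E₁ → inj₁ (i∈E₁ , ¬R ∘ P₁⇒R i)) , (λ i∈E₂ → inj₂ (i∈E₂ , ¬R ∘ P₂⇒R i)) ]
      (x∈p∪q⁻ E₁ E₂ i∈E₁∪E₂)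

lemma1 : {n m : ℕ} (E : Fin m → Subset n) → IsHypergraph E →
         (E₁ E₂ : Subset m) (P₁ P₂ : Family n) → IsPartition P₁ → IsPartition P₂ →
         (F : Family n) → Uncross (P₁ ++ P₂) F → Uncrossed F →
         eCount E E₁ P₁ + eCount E E₂ P₂
           ≥ eCount E (E₁ ∩ E₂) (minimalMembers F) + eCount E (E₁ ∪ E₂) (maximalMembers F)
lemma1 E E-hypergraph E₁ E₂ P₁ P₂ (P₁-nonempty , P₁-disjoint , _) (P₂-nonempty , P₂-disjoint , _)
       F P₁P₂⇝F F-uncrossed =
  eCount-∩-∪-≤ E E₁ E₂ P₁ P₂ (minimalMembers F) (maximalMembers F)
    (λ _ → inside-one⇒inside-maximal ∘ Any-++⁺ˡ)
    (λ _ → inside-one⇒inside-maximal ∘ Any-++⁺ʳ P₁)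
    (λ i → inside-both⇒inside-minimal F-uncrossed (0<∣p∣⇒Nonempty (E i) (<⇒≤ (E-hypergraph i))))
  where open UncrossingTwoPartitions P₁-nonempty P₁-disjoint P₂-nonempty P₂-disjoint P₁P₂⇝F
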